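{- Strong normalisation, weak normalisation and inductivity are not first-order definable. More precisely, none of $\mathrm{SN}$, $\mathrm{WN}$, $\mathrm{IND}$, $\neg\mathrm{SN}$, $\neg\mathrm{WN}$, $\neg\mathrm{IND}$ is a generalised first-order property of abstract rewrite systems.
   Context: An ARS is a pair $(A,\to)$, $A$ non-empty, ${\to}\subseteq A\times A$; $\twoheadrightarrow$ is the reflexive transitive closure. A normal form is an element with no outgoing step. SN: there is no infinite sequence $a_0\to a_1\to\cdots$. WN: every $a$ reduces ($\twoheadrightarrow$) to a normal form. IND (inductive): for every infinite sequence $a_0\to a_1\to a_2\to\cdots$ there is $a\in A$ with $a_i\twoheadrightarrow a$ for all $i$. $\neg P$ is the property of not having $P$. A property $P$ is a generalised first-order property if there is a set $\Phi$ of sentences of first-order logic with equality and a binary predicate symbol $\to$ (interpreted as the one-step relation) such that for every ARS $\mathcal{A}$, $\mathcal{A}$ has $P$ iff $\mathcal{A}\models\Phi$. -}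

module Defs where

open import Data.Nat using (ℕ; suc)
open import Data.Fin using (Fin; zero; suc)
open import Data.Product using (Σ; _×_; ∃)
open import Data.Sum using (_⊎_)
open import Data.Empty using (⊥)
open import Relation.Nullary using (¬_)
open import Relation.Binary.PropositionalEquality using (_≡_)
open import Function.Bundles using (_⇔_)

record ARS : Set₁ where
  field
    Carrier : Set
    inhabitant : Carrier
    _⟶_ : Carrier → Carrier → Set

data Star {A : Set} (R : A → A → Set) : A → A → Set where
  ε   : ∀ {a} → Star R a a
  _◅_ : ∀ {a b c} → R a b → Star R b c → Star R a c

module _ (𝒜 : ARS) where
  open ARS 𝒜

  _↠_ : Carrier → Carrier → Set
  _↠_ = Star _⟶_

  NormalForm : Carrier → Set
  NormalForm b = ∀ c → ¬ (b ⟶ c)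

  IsReductionSeq : (ℕ → Carrier) → Set
  IsReductionSeq f = ∀ i → f i ⟶ f (suc i)

Property : Set₁
Property = ARS → Set

SN : Property
SN 𝒜 = ¬ (Σ (ℕ → ARS.Carrier 𝒜) λ f → IsReductionSeq 𝒜 f)

WN : Property
WN 𝒜 = ∀ a → Σ (ARS.Carrier 𝒜) λ b → _↠_ 𝒜 a b × NormalForm 𝒜 b

IND : Property
IND 𝒜 = ∀ (f : ℕ → ARS.Carrier 𝒜) → IsReductionSeq 𝒜 f →
          Σ (ARS.Carrier 𝒜) λ a → ∀ i → _↠_ 𝒜 (f i) a

Not : Property → Property
Not P 𝒜 = ¬ P 𝒜

-- First-order formulas with equality and one binary predicate symbol ⟶,
-- variables as de Bruijn indices (Fin n = n free variables in scope).
data Formula : ℕ → Set where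
  _≐_  : ∀ {n} → Fin n → Fin n → Formula n
  rel  : ∀ {n} → Fin n → Fin n → Formula n
  ⊥'   : ∀ {n} → Formula n
  ¬'_  : ∀ {n} → Formula n → Formula n
  _∧'_ : ∀ {n} → Formula n → Formula n → Formula n
  _∨'_ : ∀ {n} → Formula n → Formula n → Formula n
  _⇒'_ : ∀ {n} → Formula n → Formula n → Formula n
  ∀'   : ∀ {n} → Formula (suc n) → Formula n
  ∃'   : ∀ {n} → Formula (suc n) → Formula n

Sentence : Set
Sentence = Formula 0

_∷ₑ_ : ∀ {A : Set} {n} → A → (Fin n → A) → Fin (suc n) → A
(a ∷ₑ ρ) zero = a
(a ∷ₑ ρ) (suc i) = ρ i

Sat : (𝒜 : ARS) → ∀ {n} → (Fin n → ARS.Carrier 𝒜) → Formula n → Set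
Sat 𝒜 ρ (x ≐ y)   = ρ x ≡ ρ y
Sat 𝒜 ρ (rel x y) = ARS._⟶_ 𝒜 (ρ x) (ρ y)
Sat 𝒜 ρ ⊥'        = ⊥
Sat 𝒜 ρ (¬' φ)    = ¬ Sat 𝒜 ρ φ
Sat 𝒜 ρ (φ ∧' ψ)  = Sat 𝒜 ρ φ × Sat 𝒜 ρ ψ
Sat 𝒜 ρ (φ ∨' ψ)  = Sat 𝒜 ρ φ ⊎ Sat 𝒜 ρ ψ
Sat 𝒜 ρ (φ ⇒' ψ)  = Sat 𝒜 ρ φ → Sat 𝒜 ρ ψ
Sat 𝒜 ρ (∀' φ)    = ∀ a → Sat 𝒜 (a ∷ₑ ρ) φ
Sat 𝒜 ρ (∃' φ)    = Σ (ARS.Carrier 𝒜) λ a → Sat 𝒜 (a ∷ₑ ρ) φ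

emptyEnv : ∀ {A : Set} → Fin 0 → A
emptyEnv ()

_⊨_ : ARS → Sentence → Set
𝒜 ⊨ φ = Sat 𝒜 emptyEnv φ

_⊨ˢ_ : ARS → (Sentence → Set) → Set
𝒜 ⊨ˢ Φ = ∀ φ → Φ φ → 𝒜 ⊨ φ

GeneralisedFirstOrder : Property → Set₁
GeneralisedFirstOrder P =
  Σ (Sentence → Set) λ Φ → ∀ (𝒜 : ARS) → P 𝒜 ⇔ (𝒜 ⊨ˢ Φ)

-- The ARS ℕ with n+1 → n is SN, WN and IND, whereas ℕ ⊎ ℤ (the same ray
-- plus an infinite descending line) has none of these properties; but the two
-- satisfy the same first-order sentences, so any set of sentences axiomatising
-- one of the six properties would hold in both or in neither.
--
-- Elementary equivalence is an Ehrenfeucht–Fraïssé argument on unions of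
-- chains. With k quantifiers left it suffices that the chosen points and the
-- origin of the ray have the same offsets of size at most 2^k in both
-- structures. A new point within 2^k of a chosen one is answered by the point
-- at the same offset from its partner (it exists: a short offset that would
-- leave the ray in one structure already does so in the other, as offsets from
-- the origin are preserved); a point far from all chosen ones is answered by a
-- point far out on the ray. Halving the threshold makes the offsets between the
-- new point and the old ones determined by the triangle inequality.
module Submission where

open import Defs
open import Data.Product using (_×_)
open import Relation.Nullary using (¬_)

open import Data.Bool using (Bool; true; false)
import Data.Bool.Properties as Bool
open import Data.Empty using (⊥-elim)
open import Data.Fin using (Fin; zero; suc)
import Data.Fin.Properties as Fin
open import Data.Integer as ℤ using (ℤ; +_; -[1+_]; _+_; _-_; -_; ∣_∣; 0ℤ; -1ℤ; +≤+)
import Data.Integer.Properties as ℤ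
open import Data.Integer.Tactic.RingSolver using (solve-∀)
open import Data.Nat as ℕ using (ℕ; zero; suc; z≤n; s≤s; _^_; _⊔_)
import Data.Nat.Properties as ℕ
open import Data.Nat.Induction using (<-wellFounded)
open import Data.Product using (Σ; _,_; proj₁; proj₂; swap)
open import Data.Sum using (_⊎_; inj₁; inj₂)
open import Data.Unit using (⊤; tt)
import Data.Unit.Properties as Unit
open import Function using (_∘_; const)
open import Function.Bundles using (Equivalence)
open import Induction.InfiniteDescent using (InfiniteDescendingSequence)
open import Induction.WellFounded using (WellFounded; Acc; acc)
open import Relation.Binary.Definitions using (DecidableEquality)
open import Relation.Binary.PropositionalEquality
open import Relation.Nullary using (Dec; yes; no)
open import Relation.Nullary.Decidable as Dec using (_×-dec_)

acc⇒¬infiniteDescent : ∀ {A : Set} {_<_ : A → A → Set} {x} → Acc _<_ x →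
  (f : ℕ → A) → f 0 ≡ x → ¬ InfiniteDescendingSequence _<_ f
acc⇒¬infiniteDescent (acc rs) f refl desc =
  acc⇒¬infiniteDescent (rs (desc 0)) (f ∘ suc) refl (desc ∘ suc)

wellFounded⇒¬infiniteDescent : ∀ {A : Set} {_<_ : A → A → Set} → WellFounded _<_ →
  (f : ℕ → A) → ¬ InfiniteDescendingSequence _<_ f
wellFounded⇒¬infiniteDescent wf f = acc⇒¬infiniteDescent (wf (f 0)) f refl

SN⇒IND : ∀ 𝒜 → SN 𝒜 → IND 𝒜
SN⇒IND 𝒜 sn f seq = ⊥-elim (sn (f , seq))

separating-¬GeneralisedFirstOrder : ∀ {𝒜 ℬ : ARS} → (∀ φ → 𝒜 ⊨ φ → ℬ ⊨ φ) →
  ∀ {P} → P 𝒜 → ¬ P ℬ → ¬ GeneralisedFirstOrder P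
separating-¬GeneralisedFirstOrder {𝒜} {ℬ} 𝒜⇒ℬ P𝒜 ¬Pℬ (_ , axiomatises) =
  ¬Pℬ (Equivalence.from (axiomatises ℬ)
         (λ φ φ∈Φ → 𝒜⇒ℬ φ (Equivalence.to (axiomatises 𝒜) P𝒜 φ φ∈Φ)))

sign-change⇒∣i∣<∣j∣ : ∀ i j → 0ℤ ℤ.≤ i → ¬ 0ℤ ℤ.≤ i + j → ∣ i ∣ ℕ.< ∣ j ∣
sign-change⇒∣i∣<∣j∣ (+ m) (+ n)    _ i+j≱0 = ⊥-elim (i+j≱0 (+≤+ z≤n))
sign-change⇒∣i∣<∣j∣ (+ m) -[1+ n ] _ i+j≱0 with m ℕ.≤? n
... | yes m≤n = s≤s m≤n
... | no  m≰n = ⊥-elim (i+j≱0 (subst (0ℤ ℤ.≤_) (sym (ℤ.≤-⊖ (ℕ.≰⇒> m≰n))) (+≤+ z≤n)))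

i≰-[1+∣i∣] : ∀ i → ¬ i ℤ.≤ -[1+ ∣ i ∣ ]
i≰-[1+∣i∣] (+ m) ()
i≰-[1+∣i∣] -[1+ m ] (ℤ.-≤- m<m) = ℕ.n≮n m m<m

record Short (k : ℕ) (d : ℤ) : Set where
  constructor short
  field ∣d∣≤2^k : ∣ d ∣ ℕ.≤ 2 ^ k

short? : ∀ k d → Dec (Short k d)
short? k d = Dec.map′ short Short.∣d∣≤2^k (∣ d ∣ ℕ.≤? 2 ^ k)

short-0 : ∀ k → Short k 0ℤ
short-0 k = short z≤n

short--1 : ∀ k → Short k -1ℤ
short--1 k = short (ℕ.m^n>0 2 k)

short-suc : ∀ {k d} → Short k d → Short (suc k) d
short-suc {k} (short s) = short (ℕ.≤-trans s (ℕ.m≤m+n (2 ^ k) (2 ^ k ℕ.+ 0)))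

short-neg : ∀ {k d} → Short k d → Short k (- d)
short-neg {d = d} (short s) = short (subst (ℕ._≤ _) (sym (ℤ.∣-i∣≡∣i∣ d)) s)

short-+ : ∀ {k d e} → Short k d → Short k e → Short (suc k) (d + e)
short-+ {k} {d} {e} (short sd) (short se) = short (ℕ.≤-trans (ℤ.∣i+j∣≤∣i∣+∣j∣ d e)
  (ℕ.≤-trans (ℕ.+-mono-≤ sd se) (ℕ.≤-reflexive (cong (2 ^ k ℕ.+_) (sym (ℕ.+-identityʳ (2 ^ k)))))))

supremum : ∀ {n} → (Fin n → ℕ) → ℕ
supremum {zero}  f = 0
supremum {suc n} f = f zero ⊔ supremum (f ∘ suc)

≤-supremum : ∀ {n} (f : Fin n → ℕ) i → f i ℕ.≤ supremum f
≤-supremum f zero    = ℕ.m≤m⊔n (f zero) _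
≤-supremum f (suc i) = ℕ.≤-trans (≤-supremum (f ∘ suc) i) (ℕ.m≤n⊔m (f zero) _)

-- Unions of chains

-- A ray ℕ, whose origin is the only point without a left neighbour, together
-- with copies of ℤ; a point is given by its chain and its position there.
record Chains : Set₁ where
  field
    Point        : Set
    Chain        : Set
    _≟_          : DecidableEquality Chain
    ray          : Chain
    chain        : Point → Chain
    pos          : Point → ℤ
    origin       : Point
    origin-chain : chain origin ≡ ray
    origin-pos   : pos origin ≡ 0ℤ
    ray-nonneg   : ∀ x → chain x ≡ ray → 0ℤ ℤ.≤ pos x
    translate    : ∀ x e → (chain x ≡ ray → 0ℤ ℤ.≤ pos x + e) →
                   Σ Point λ y → chain x ≡ chain y × pos y ≡ pos x + e
    coordinates-injective : ∀ {x y} → chain x ≡ chain y → pos x ≡ pos y → x ≡ y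

open Chains hiding (_≟_)

Offset : (S : Chains) → Point S → Point S → ℤ → Set
Offset S x y d = chain S x ≡ chain S y × pos S y ≡ pos S x + d

toARS : Chains → ARS
toARS S = record
  { Carrier = Point S ; inhabitant = origin S ; _⟶_ = λ x y → Offset S x y -1ℤ }

module _ (S : Chains) where

  offset-refl : ∀ {x} → Offset S x x 0ℤ
  offset-refl {x} = refl , sym (ℤ.+-identityʳ (pos S x))

  offset-trans : ∀ {x y z d e} → Offset S x y d → Offset S y z e → Offset S x z (d + e)
  offset-trans {x} {d = d} {e} (cxy , py) (cyz , pz) =
    trans cxy cyz , trans pz (trans (cong (_+ e) py) (ℤ.+-assoc (pos S x) d e))

  offset-sym : ∀ {x y d} → Offset S x y d → Offset S y x (- d)
  offset-sym {x} {y} {d} (c , p) = sym c , (begin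
    pos S x            ≡⟨ a≡[a+d]-d (pos S x) d ⟩
    (pos S x + d) - d  ≡⟨ cong (_- d) (sym p) ⟩
    pos S y - d        ∎)
    where
    open ≡-Reasoning
    a≡[a+d]-d : ∀ a d → a ≡ (a + d) - d
    a≡[a+d]-d = solve-∀

  offset-displacement : ∀ {x y d} → Offset S x y d → pos S y - pos S x ≡ d
  offset-displacement {x} {d = d} (_ , p) =
    trans (cong (_- pos S x) p) ([a+d]-a≡d (pos S x) d)
    where
    [a+d]-a≡d : ∀ a d → (a + d) - a ≡ d
    [a+d]-a≡d = solve-∀

  offset-by-displacement : ∀ {x y} → chain S x ≡ chain S y → Offset S x y (pos S y - pos S x)
  offset-by-displacement {x} {y} c = c , b≡a+[b-a] (pos S y) (pos S x)
    where
    b≡a+[b-a] : ∀ b a → b ≡ a + (b - a)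
    b≡a+[b-a] = solve-∀

  offset-self : ∀ {x d} → Offset S x x d → d ≡ 0ℤ
  offset-self {x} o = trans (sym (offset-displacement o)) (ℤ.+-inverseʳ (pos S x))

  ≡⇒offset-0 : ∀ {x y} → x ≡ y → Offset S x y 0ℤ
  ≡⇒offset-0 refl = offset-refl

  offset-0⇒≡ : ∀ {x y} → Offset S x y 0ℤ → x ≡ y
  offset-0⇒≡ {x} (c , p) = coordinates-injective S c (sym (trans p (ℤ.+-identityʳ (pos S x))))

  offset-from-origin : ∀ {x} → chain S x ≡ ray S → Offset S (origin S) x (pos S x)
  offset-from-origin {x} x∈ray =
    trans (origin-chain S) (sym x∈ray) ,
    sym (trans (cong (_+ pos S x) (origin-pos S)) (ℤ.+-identityˡ (pos S x)))

  offset-from-origin-nonneg : ∀ {x d} → Offset S (origin S) x d → 0ℤ ℤ.≤ d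
  offset-from-origin-nonneg {x} {d} (c , p) =
    subst (0ℤ ℤ.≤_) (trans p (trans (cong (_+ d) (origin-pos S)) (ℤ.+-identityˡ d)))
      (ray-nonneg S x (trans (sym c) (origin-chain S)))

  off-ray-reducible : ∀ {x} → ¬ chain S x ≡ ray S → ¬ NormalForm (toARS S) x
  off-ray-reducible {x} x∉ray nf = nf (proj₁ step) (proj₂ step)
    where step = translate S x -1ℤ (⊥-elim ∘ x∉ray)

  ↠-preserves-chain : ∀ {x y} → _↠_ (toARS S) x y → chain S x ≡ chain S y
  ↠-preserves-chain ε              = refl
  ↠-preserves-chain ((c , _) ◅ xs) = trans c (↠-preserves-chain xs)

  ↠-decreases-pos : ∀ {x y} → _↠_ (toARS S) x y → pos S y ℤ.≤ pos S x
  ↠-decreases-pos ε = ℤ.≤-refl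
  ↠-decreases-pos {x} ((_ , p) ◅ xs) =
    ℤ.≤-trans (↠-decreases-pos xs) (ℤ.≤-trans (ℤ.≤-reflexive p) (ℤ.i-j≤i (pos S x) (+ 1)))

-- Ehrenfeucht–Fraïssé games

withOrigin : (S : Chains) → ∀ {n} → (Fin n → Point S) → Fin (suc n) → Point S
withOrigin S ρ = origin S ∷ₑ ρ

Preserves : (S T : Chains) → ℕ → ∀ {n} → (Fin n → Point S) → (Fin n → Point T) → Set
Preserves S T k ρ σ = ∀ i j d → Short k d →
  Offset S (withOrigin S ρ i) (withOrigin S ρ j) d →
  Offset T (withOrigin T σ i) (withOrigin T σ j) d

Matched : (S T : Chains) → ℕ → ∀ {n} → (Fin n → Point S) → (Fin n → Point T) → Set
Matched S T k ρ σ = Preserves S T k ρ σ × Preserves T S k σ ρ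

Isolated : (S : Chains) → ℕ → ∀ {n} → (Fin n → Point S) → Point S → Set
Isolated S k ρ a = ∀ i d → Short k d → ¬ Offset S (withOrigin S ρ i) a d

self-offset-preserved : (S T : Chains) {x : Point S} {y : Point T} {d : ℤ} →
  Offset S x x d → Offset T y y d
self-offset-preserved S T o = subst (Offset T _ _) (sym (offset-self S o)) (offset-refl T)

preserves-[] : (S T : Chains) (k : ℕ) → Preserves S T k emptyEnv emptyEnv
preserves-[] S T k zero zero d _ = self-offset-preserved S T

module _ (S T : Chains) {k n : ℕ} {ρ : Fin n → Point S} {σ : Fin n → Point T} where

  preserves-weaken : Preserves S T (suc k) ρ σ → Preserves S T k ρ σ
  preserves-weaken pres i j d short-d = pres i j d (short-suc short-d)

  module _ {a : Point S} {b : Point T} where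

    -- Index zero is the origin, index one the new point.
    preserves-∷ : Preserves S T k ρ σ →
      (∀ j d → Short k d → Offset S a (withOrigin S ρ j) d → Offset T b (withOrigin T σ j) d) →
      (∀ i d → Short k d → Offset S (withOrigin S ρ i) a d → Offset T (withOrigin T σ i) b d) →
      Preserves S T k (a ∷ₑ ρ) (b ∷ₑ σ)
    preserves-∷ old new-old old-new zero          zero          = old zero zero
    preserves-∷ old new-old old-new zero          (suc zero)    = old-new zero
    preserves-∷ old new-old old-new zero          (suc (suc j)) = old zero (suc j)
    preserves-∷ old new-old old-new (suc zero)    zero          = new-old zero
    preserves-∷ old new-old old-new (suc zero)    (suc zero)    = λ _ _ → self-offset-preserved S T
    preserves-∷ old new-old old-new (suc zero)    (suc (suc j)) = new-old (suc j)
    preserves-∷ old new-old old-new (suc (suc i)) zero          = old (suc i) zero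
    preserves-∷ old new-old old-new (suc (suc i)) (suc zero)    = old-new (suc i)
    preserves-∷ old new-old old-new (suc (suc i)) (suc (suc j)) = old (suc i) (suc j)

    preserves-∷-near : Preserves S T (suc k) ρ σ → ∀ m {e} → Short k e →
      Offset S (withOrigin S ρ m) a e → Offset T (withOrigin T σ m) b e →
      Preserves S T k (a ∷ₑ ρ) (b ∷ₑ σ)
    preserves-∷-near pres m {e} short-e xa yb =
      preserves-∷ (preserves-weaken pres) new-old old-new
      where
      -e+[e+d]≡d : ∀ e d → - e + (e + d) ≡ d
      -e+[e+d]≡d = solve-∀
      [d-e]+e≡d : ∀ d e → (d - e) + e ≡ d
      [d-e]+e≡d = solve-∀

      new-old : ∀ j d → Short k d → Offset S a (withOrigin S ρ j) d →
                Offset T b (withOrigin T σ j) d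
      new-old j d short-d ao = subst (Offset T _ _) (-e+[e+d]≡d e d)
        (offset-trans T (offset-sym T yb)
          (pres m j (e + d) (short-+ short-e short-d) (offset-trans S xa ao)))

      old-new : ∀ i d → Short k d → Offset S (withOrigin S ρ i) a d →
                Offset T (withOrigin T σ i) b d
      old-new i d short-d oa = subst (Offset T _ _) ([d-e]+e≡d d e)
        (offset-trans T
          (pres i m (d - e) (short-+ short-d (short-neg short-e))
            (offset-trans S oa (offset-sym S xa)))
          yb)

    preserves-∷-isolated : Preserves S T (suc k) ρ σ → Isolated S k ρ a →
      Preserves S T k (a ∷ₑ ρ) (b ∷ₑ σ)
    preserves-∷-isolated pres isolated = preserves-∷ (preserves-weaken pres)
      (λ j d short-d ao → ⊥-elim (isolated j (- d) (short-neg short-d) (offset-sym S ao)))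
      (λ i d short-d oa → ⊥-elim (isolated i d short-d oa))

  translate-matched : Preserves T S (suc k) σ ρ → ∀ m {a e} → Short k e →
    Offset S (withOrigin S ρ m) a e → Σ (Point T) λ b → Offset T (withOrigin T σ m) b e
  translate-matched back m {e = e} short-e xa = translate T y e stays-on-ray
    where
    y = withOrigin T σ m
    stays-on-ray : chain T y ≡ ray T → 0ℤ ℤ.≤ pos T y + e
    stays-on-ray y∈ray with 0ℤ ℤ.≤? pos T y + e
    ... | yes y+e≥0 = y+e≥0
    ... | no  y+e≱0 =
      ⊥-elim (y+e≱0 (offset-from-origin-nonneg S (offset-trans S origin-x xa)))
      where
      short-y : Short (suc k) (pos T y)
      short-y = short-suc (short (ℕ.≤-trans
        (ℕ.<⇒≤ (sign-change⇒∣i∣<∣j∣ (pos T y) e (ray-nonneg T y y∈ray) y+e≱0))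
        (Short.∣d∣≤2^k short-e)))
      origin-x : Offset S (origin S) (withOrigin S ρ m) (pos T y)
      origin-x = back zero m (pos T y) short-y (offset-from-origin T y∈ray)

far-point : (T : Chains) (k : ℕ) {n : ℕ} (σ : Fin n → Point T) → Σ (Point T) (Isolated T k σ)
far-point T k σ = proj₁ moved , isolated
  where
  M = supremum (∣_∣ ∘ pos T ∘ withOrigin T σ)
  N = suc (M ℕ.+ 2 ^ k)
  N-nonneg : chain T (origin T) ≡ ray T → 0ℤ ℤ.≤ pos T (origin T) + + N
  N-nonneg _ rewrite origin-pos T = +≤+ z≤n
  moved = translate T (origin T) (+ N) N-nonneg
  pos-moved : pos T (proj₁ moved) ≡ + N
  pos-moved = trans (proj₂ (proj₂ moved))
    (trans (cong (_+ + N) (origin-pos T)) (ℤ.+-identityˡ (+ N)))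
  isolated : Isolated T k σ (proj₁ moved)
  isolated i d (short ∣d∣≤2^k) (_ , p) = ℕ.1+n≰n (begin
    N                                   ≡⟨ cong ∣_∣ (trans (sym pos-moved) p) ⟩
    ∣ pos T (withOrigin T σ i) + d ∣    ≤⟨ ℤ.∣i+j∣≤∣i∣+∣j∣ (pos T (withOrigin T σ i)) d ⟩
    ∣ pos T (withOrigin T σ i) ∣ ℕ.+ ∣ d ∣
      ≤⟨ ℕ.+-mono-≤ (≤-supremum (∣_∣ ∘ pos T ∘ withOrigin T σ) i) ∣d∣≤2^k ⟩
    M ℕ.+ 2 ^ k                         ∎)
    where open ℕ.≤-Reasoning

Close : (S : Chains) → ℕ → Point S → Point S → Set
Close S k x a = chain S x ≡ chain S a × Short k (pos S a - pos S x)

close? : (S : Chains) (k : ℕ) → ∀ x a → Dec (Close S k x a)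
close? S k x a =
  Chains._≟_ S (chain S x) (chain S a) ×-dec short? k (pos S a - pos S x)

matched-forth : (S T : Chains) (k : ℕ) {n : ℕ} {ρ : Fin n → Point S} {σ : Fin n → Point T} →
  Matched S T (suc k) ρ σ → (a : Point S) → Σ (Point T) λ b → Matched S T k (a ∷ₑ ρ) (b ∷ₑ σ)
matched-forth S T k {ρ = ρ} {σ} (there , back) a
  with Fin.any? (λ m → close? S k (withOrigin S ρ m) a)
... | yes (m , same-chain , short-e) =
  proj₁ moved ,
  preserves-∷-near S T there m short-e xa (proj₂ moved) ,
  preserves-∷-near T S back m short-e (proj₂ moved) xa
  where
  xa = offset-by-displacement S same-chain
  moved = translate-matched S T back m short-e xa
... | no far =
  proj₁ faraway ,
  preserves-∷-isolated S T there isolated ,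
  preserves-∷-isolated T S back (proj₂ faraway)
  where
  isolated : Isolated S k ρ a
  isolated i d short-d o =
    far (i , proj₁ o , subst (Short k) (sym (offset-displacement S o)) short-d)
  faraway = far-point T k σ

quantifierDepth : ∀ {n} → Formula n → ℕ
quantifierDepth (x ≐ y)   = 0
quantifierDepth (rel x y) = 0
quantifierDepth ⊥'        = 0
quantifierDepth (¬' φ)    = quantifierDepth φ
quantifierDepth (φ ∧' ψ)  = quantifierDepth φ ⊔ quantifierDepth ψ
quantifierDepth (φ ∨' ψ)  = quantifierDepth φ ⊔ quantifierDepth ψ
quantifierDepth (φ ⇒' ψ)  = quantifierDepth φ ⊔ quantifierDepth ψ
quantifierDepth (∀' φ)    = suc (quantifierDepth φ)
quantifierDepth (∃' φ)    = suc (quantifierDepth φ)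

Sat-transfer : (S T : Chains) {n : ℕ} (φ : Formula n) (k : ℕ) → quantifierDepth φ ℕ.≤ k →
  {ρ : Fin n → Point S} {σ : Fin n → Point T} → Matched S T k ρ σ →
  Sat (toARS S) ρ φ → Sat (toARS T) σ φ
Sat-transfer S T (x ≐ y) k _ (there , _) x≡y =
  offset-0⇒≡ T (there (suc x) (suc y) 0ℤ (short-0 k) (≡⇒offset-0 S x≡y))
Sat-transfer S T (rel x y) k _ (there , _) = there (suc x) (suc y) -1ℤ (short--1 k)
Sat-transfer S T ⊥' k _ _ ()
Sat-transfer S T (¬' φ) k q m ¬sφ sφ = ¬sφ (Sat-transfer T S φ k q (swap m) sφ)
Sat-transfer S T (φ ∧' ψ) k q m (sφ , sψ) =
  Sat-transfer S T φ k (ℕ.m⊔n≤o⇒m≤o _ _ q) m sφ ,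
  Sat-transfer S T ψ k (ℕ.m⊔n≤o⇒n≤o _ _ q) m sψ
Sat-transfer S T (φ ∨' ψ) k q m (inj₁ sφ) = inj₁ (Sat-transfer S T φ k (ℕ.m⊔n≤o⇒m≤o _ _ q) m sφ)
Sat-transfer S T (φ ∨' ψ) k q m (inj₂ sψ) = inj₂ (Sat-transfer S T ψ k (ℕ.m⊔n≤o⇒n≤o _ _ q) m sψ)
Sat-transfer S T (φ ⇒' ψ) k q m φ⇒ψ sφ =
  Sat-transfer S T ψ k (ℕ.m⊔n≤o⇒n≤o _ _ q) m
    (φ⇒ψ (Sat-transfer T S φ k (ℕ.m⊔n≤o⇒m≤o _ _ q) (swap m) sφ))
Sat-transfer S T (∀' φ) (suc k) (s≤s q) m ∀φ b =
  Sat-transfer S T φ k q (swap (proj₂ answer)) (∀φ (proj₁ answer))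
  where answer = matched-forth T S k (swap m) b
Sat-transfer S T (∃' φ) (suc k) (s≤s q) m (a , sφ) =
  proj₁ answer , Sat-transfer S T φ k q (proj₂ answer) sφ
  where answer = matched-forth S T k m a

⊨-transfer : (S T : Chains) (φ : Sentence) → toARS S ⊨ φ → toARS T ⊨ φ
⊨-transfer S T φ = Sat-transfer S T φ k ℕ.≤-refl (preserves-[] S T k , preserves-[] T S k)
  where k = quantifierDepth φ

-- The two rewrite systems

ℕ-ray : Chains
ℕ-ray = record
  { Point = ℕ ; Chain = ⊤ ; _≟_ = Unit._≟_ ; ray = tt ; chain = const tt ; pos = +_
  ; origin = 0 ; origin-chain = refl ; origin-pos = refl
  ; ray-nonneg = λ _ _ → +≤+ z≤n
  ; translate = λ x e x+e≥0 → ∣ + x + e ∣ , refl , ℤ.0≤i⇒+∣i∣≡i (x+e≥0 refl)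
  ; coordinates-injective = λ _ → ℤ.+-injective
  }

ℕ⊎ℤ : Chains
ℕ⊎ℤ = record
  { Point = ℕ ⊎ ℤ ; Chain = Bool ; _≟_ = Bool._≟_ ; ray = false
  ; chain = onLine ; pos = position
  ; origin = inj₁ 0 ; origin-chain = refl ; origin-pos = refl
  ; ray-nonneg = ray-nonneg′ ; translate = translate′
  ; coordinates-injective = coordinates-injective′
  }
  where
  onLine : ℕ ⊎ ℤ → Bool
  onLine (inj₁ _) = false
  onLine (inj₂ _) = true

  position : ℕ ⊎ ℤ → ℤ
  position (inj₁ n) = + n
  position (inj₂ z) = z

  ray-nonneg′ : ∀ x → onLine x ≡ false → 0ℤ ℤ.≤ position x
  ray-nonneg′ (inj₁ n) _ = +≤+ z≤n

  translate′ : ∀ x e → (onLine x ≡ false → 0ℤ ℤ.≤ position x + e) →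
    Σ (ℕ ⊎ ℤ) λ y → onLine x ≡ onLine y × position y ≡ position x + e
  translate′ (inj₁ n) e n+e≥0 = inj₁ ∣ + n + e ∣ , refl , ℤ.0≤i⇒+∣i∣≡i (n+e≥0 refl)
  translate′ (inj₂ z) e _     = inj₂ (z + e) , refl , refl

  coordinates-injective′ : ∀ {x y} → onLine x ≡ onLine y → position x ≡ position y → x ≡ y
  coordinates-injective′ {inj₁ m} {inj₁ n} _ p = cong inj₁ (ℤ.+-injective p)
  coordinates-injective′ {inj₂ z} {inj₂ w} _ p = cong inj₂ p

SN-ℕ : SN (toARS ℕ-ray)
SN-ℕ (f , seq) = wellFounded⇒¬infiniteDescent <-wellFounded f (λ i → step-< (proj₂ (seq i)))
  where
  [a+-1]+1≡a : ∀ a → (a + -1ℤ) + + 1 ≡ a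
  [a+-1]+1≡a = solve-∀
  step-< : ∀ {m n} → + n ≡ + m + -1ℤ → n ℕ.< m
  step-< {m} {n} p = subst (n ℕ.<_)
    (ℤ.+-injective (trans (cong (_+ + 1) p) ([a+-1]+1≡a (+ m))))
    (ℕ.m<m+n n (s≤s z≤n))

WN-ℕ : WN (toARS ℕ-ray)
WN-ℕ n = 0 , ↠0 n , λ _ ()
  where
  [1+a]+-1≡a : ∀ a → (+ 1 + a) + -1ℤ ≡ a
  [1+a]+-1≡a = solve-∀
  ↠0 : ∀ n → _↠_ (toARS ℕ-ray) n 0
  ↠0 zero    = ε
  ↠0 (suc n) = (refl , sym ([1+a]+-1≡a (+ n))) ◅ ↠0 n

descending-line : ℕ → ℕ ⊎ ℤ
descending-line i = inj₂ -[1+ i ]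

descending-line-reduces : IsReductionSeq (toARS ℕ⊎ℤ) descending-line
descending-line-reduces i = refl , cong (λ j → -[1+ suc j ]) (sym (ℕ.+-identityʳ i))

¬SN-ℕ⊎ℤ : ¬ SN (toARS ℕ⊎ℤ)
¬SN-ℕ⊎ℤ sn = sn (descending-line , descending-line-reduces)

¬WN-ℕ⊎ℤ : ¬ WN (toARS ℕ⊎ℤ)
¬WN-ℕ⊎ℤ wn with wn (inj₂ 0ℤ)
... | b , 0↠b , nf = off-ray-reducible ℕ⊎ℤ b∉ray nf
  where
  b∉ray : ¬ chain ℕ⊎ℤ b ≡ ray ℕ⊎ℤ
  b∉ray b∈ray with trans (↠-preserves-chain ℕ⊎ℤ 0↠b) b∈ray
  ... | ()

¬IND-ℕ⊎ℤ : ¬ IND (toARS ℕ⊎ℤ)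
¬IND-ℕ⊎ℤ ind with ind descending-line descending-line-reduces
... | a , ↠a = i≰-[1+∣i∣] (pos ℕ⊎ℤ a) (↠-decreases-pos ℕ⊎ℤ (↠a ∣ pos ℕ⊎ℤ a ∣))

theorem3p17 : ¬ GeneralisedFirstOrder SN × ¬ GeneralisedFirstOrder WN
    × ¬ GeneralisedFirstOrder IND × ¬ GeneralisedFirstOrder (Not SN)
    × ¬ GeneralisedFirstOrder (Not WN) × ¬ GeneralisedFirstOrder (Not IND)
theorem3p17 =
  separating ℕ⇒ℕ⊎ℤ SN-ℕ ¬SN-ℕ⊎ℤ ,
  separating ℕ⇒ℕ⊎ℤ WN-ℕ ¬WN-ℕ⊎ℤ ,
  separating ℕ⇒ℕ⊎ℤ IND-ℕ ¬IND-ℕ⊎ℤ ,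
  separating ℕ⊎ℤ⇒ℕ ¬SN-ℕ⊎ℤ (λ ¬SN → ¬SN SN-ℕ) ,
  separating ℕ⊎ℤ⇒ℕ ¬WN-ℕ⊎ℤ (λ ¬WN → ¬WN WN-ℕ) ,
  separating ℕ⊎ℤ⇒ℕ ¬IND-ℕ⊎ℤ (λ ¬IND → ¬IND IND-ℕ)
  where
  separating = separating-¬GeneralisedFirstOrder
  ℕ⇒ℕ⊎ℤ = ⊨-transfer ℕ-ray ℕ⊎ℤ
  ℕ⊎ℤ⇒ℕ = ⊨-transfer ℕ⊎ℤ ℕ-ray
  IND-ℕ = SN⇒IND (toARS ℕ-ray) SN-ℕ
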